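{- Let $T$ be an $n$-tournament with $V(T)=\{v_1,\ldots,v_n\}$ and let $\hat T=T(a_1,\ldots,a_n)$ be a transitive blowup of $T$. If $\hat T$ is a CR tournament, then $T$ is a CR tournament.
   Context: A tournament is a digraph with exactly one arc between each pair of distinct vertices. For distinct vertices write $\theta_T(u,v)=1$ if $u\to v$, $-1$ otherwise. Skew-adjacency matrix $S_T$: entry $1$ if $v_i\to v_j$, $-1$ if $v_j\to v_i$, $0$ on the diagonal; $\det(T)=\det(S_T)$. For odd $k\ge1$, $\mathcal{D}_k$ is the set of tournaments all of whose induced subtournaments have determinant at most $k^2$; $\mathcal{D}_{ -1}=\emptyset$. Transitive blowup $T(a_1,\dots,a_n)$ ($a_i\ge1$): replace each $v_i$ by a transitive tournament $H_i$ on $a_i$ vertices, with all arcs from $V(H_i)$ to $V(H_j)$ whenever $v_i\to v_j$. A diamond is a 4-tournament consisting of a 3-cycle plus a vertex dominating all of it or dominated by all of it. Two vertices $u_1,u_2$ of $R$ are covertices and revertices if $|V(R)|=2$; if $|V(R)|\ge3$ they are covertices if $\theta_R(u_1,v)=\theta_R(u_2,v)$ for all other $v$, revertices if $\theta_R(u_1,v)=-\theta_R(u_2,v)$ for all other $v$; CR-associated if covertices or revertices. For $u\notin V(R)=\{w_1,\dots,w_m\}$ and $\sigma=(r_1,\dots,r_m)\in\{\pm1\}^m$, $R(u,\sigma)$ extends $R$ by $u$ with $u\to w_i$ iff $r_i=1$; $u$ is a CR vertex for $R$ with $\sigma$ if $u$ is CR-associated in $R(u,\sigma)$ with some vertex of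 $R$, otherwise a non-CR vertex. Let $R\in\mathcal{D}_k\setminus\mathcal{D}_{k-2}$ for some odd $k$. $R$ is a CR tournament if $R$ is a 1-tournament, a 2-tournament or a diamond, or else for every $u\notin V(R)$ and every $\sigma$ with $u$ a non-CR vertex for $R$ with $\sigma$, $R(u,\sigma)\notin\mathcal{D}_k$. -}

module Defs where

open import Data.Nat as ℕ using (ℕ; zero; suc)
open import Data.Integer as ℤ using (ℤ; +_; -_)
open import Data.Fin as Fin using (Fin; zero; suc; punchIn; toℕ)
open import Data.Bool using (Bool; true; false; not; if_then_else_)
open import Data.Bool.Properties using (not-involutive)
open import Data.Empty using (⊥)
open import Data.Product using (Σ; ∃; _×_; _,_)
open import Data.Sum using (_⊎_)
open import Function using (_∘_)
open import Function.Definitions using (Injective)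
open import Relation.Nullary using (¬_; does)
open import Relation.Binary.PropositionalEquality using (_≡_; _≢_; refl; cong)

record Tournament (n : ℕ) : Set where
  field
    arc    : Fin n → Fin n → Bool          -- arc u v ≡ true  iff  u → v
    irrefl : ∀ i → arc i i ≡ false
    tourn  : ∀ i j → i ≢ j → arc j i ≡ not (arc i j)
open Tournament public

θ : ∀ {n} → Tournament n → Fin n → Fin n → ℤ
θ T u v = if arc T u v then + 1 else - (+ 1)

S : ∀ {n} → Tournament n → Fin n → Fin n → ℤ
S T i j = if does (i Fin.≟ j) then + 0 else θ T i j

sumFin : ∀ {n} → (Fin n → ℤ) → ℤ
sumFin {zero}  f = + 0
sumFin {suc n} f = f zero ℤ.+ sumFin (f ∘ suc)

sign : ℕ → ℤ
sign zero    = + 1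
sign (suc k) = - sign k

det : ∀ {n} → (Fin n → Fin n → ℤ) → ℤ
det {zero}  M = + 1
det {suc n} M =
  sumFin λ j → sign (toℕ j) ℤ.* M zero j ℤ.* det (λ r c → M (suc r) (punchIn j c))

detT : ∀ {n} → Tournament n → ℤ
detT T = det (S T)

-- InD t T means T ∈ D_{2t-1}; so InD 0 = D_{-1} = ∅
-- and InD (suc t) = D_{2t+1}.  Induced subtournaments are given by
-- injections f : Fin m → Fin n (the skew-adjacency matrix of the induced
-- subtournament on the image of f, in the order given by f).

InD : ∀ {n} → ℕ → Tournament n → Set
InD zero    T = ⊥
InD {n} (suc t) T =
  ∀ (m : ℕ) (f : Fin m → Fin n) → Injective _≡_ _≡_ f →
  det (λ i j → S T (f i) (f j)) ℤ.≤ + ((1 ℕ.+ 2 ℕ.* t) ℕ.* (1 ℕ.+ 2 ℕ.* t))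

Covertices : ∀ {n} → Tournament n → Fin n → Fin n → Set
Covertices {n} R u₁ u₂ =
  n ≡ 2 ⊎ (3 ℕ.≤ n × (∀ v → v ≢ u₁ → v ≢ u₂ → θ R u₁ v ≡ θ R u₂ v))

Revertices : ∀ {n} → Tournament n → Fin n → Fin n → Set
Revertices {n} R u₁ u₂ =
  n ≡ 2 ⊎ (3 ℕ.≤ n × (∀ v → v ≢ u₁ → v ≢ u₂ → θ R u₁ v ≡ - θ R u₂ v))

CRAssociated : ∀ {n} → Tournament n → Fin n → Fin n → Set
CRAssociated R u₁ u₂ = Covertices R u₁ u₂ ⊎ Revertices R u₁ u₂

-- Extension R(u,σ): the new vertex u is `zero`, vertex w_i of R is `suc i`,
-- and u → w_i iff σ i ≡ true  (σ i ≡ true encodes r_i = 1).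

extArc : ∀ {m} → Tournament m → (Fin m → Bool) → Fin (suc m) → Fin (suc m) → Bool
extArc R σ zero    zero    = false
extArc R σ zero    (suc j) = σ j
extArc R σ (suc i) zero    = not (σ i)
extArc R σ (suc i) (suc j) = arc R i j

extIrrefl : ∀ {m} (R : Tournament m) σ i → extArc R σ i i ≡ false
extIrrefl R σ zero    = refl
extIrrefl R σ (suc i) = irrefl R i

extTourn : ∀ {m} (R : Tournament m) σ i j → i ≢ j → extArc R σ j i ≡ not (extArc R σ i j)
extTourn R σ zero    zero    p = Data.Empty.⊥-elim (p refl)
  where import Data.Empty
extTourn R σ zero    (suc j) p = refl
extTourn R σ (suc i) zero    p = Relation.Binary.PropositionalEquality.sym (not-involutive (σ i))
  where import Relation.Binary.PropositionalEquality
extTourn R σ (suc i) (suc j) p = tourn R i j (λ e → p (cong suc e))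

ext : ∀ {m} → Tournament m → (Fin m → Bool) → Tournament (suc m)
ext R σ = record { arc = extArc R σ ; irrefl = extIrrefl R σ ; tourn = extTourn R σ }

CRVertex : ∀ {m} → Tournament m → (Fin m → Bool) → Set
CRVertex {m} R σ = ∃ λ (w : Fin m) → CRAssociated (ext R σ) zero (suc w)

IsDiamond : ∀ {n} → Tournament n → Set
IsDiamond {n} T =
  n ≡ 4 × Σ (Fin n) λ a → Σ (Fin n) λ b → Σ (Fin n) λ c → Σ (Fin n) λ d →
    (a ≢ b × b ≢ c × a ≢ c × d ≢ a × d ≢ b × d ≢ c) ×
    (arc T a b ≡ true × arc T b c ≡ true × arc T c a ≡ true) ×
    ((arc T d a ≡ true × arc T d b ≡ true × arc T d c ≡ true) ⊎
     (arc T a d ≡ true × arc T b d ≡ true × arc T c d ≡ true))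

-- CR tournaments.  R ∈ D_k \ D_{k-2} with k = 2t+1.

IsCR : ∀ {m} → Tournament m → Set
IsCR {m} R = Σ ℕ λ t → InD (suc t) R × ¬ InD t R ×
  (m ≡ 1 ⊎ m ≡ 2 ⊎ IsDiamond R ⊎
   (∀ (σ : Fin m → Bool) → ¬ CRVertex R σ → ¬ InD (suc t) (ext R σ)))

-- T̂ (on Fin N) is T(a_1,…,a_n): p x is the vertex
-- v_i whose block H_i contains x; e i enumerates H_i bijectively by
-- Fin (a i); arcs between distinct blocks follow T; each block is a
-- transitive tournament.

IsTransitiveBlowup : ∀ {n N} → Tournament n → (Fin n → ℕ) → Tournament N → Set
IsTransitiveBlowup {n} {N} T a T̂ =
  Σ (Fin N → Fin n) λ p →
  Σ ((i : Fin n) → Fin (a i) → Fin N) λ e →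
    (∀ i → Injective _≡_ _≡_ (e i)) ×
    (∀ i j → p (e i j) ≡ i) ×
    (∀ x → ∃ λ j → e (p x) j ≡ x) ×
    (∀ x y → p x ≢ p y → arc T̂ x y ≡ arc T (p x) (p y)) ×
    (∀ x y z → p x ≡ p y → p y ≡ p z →
       arc T̂ x y ≡ true → arc T̂ y z ≡ true → arc T̂ x z ≡ true)

-- Let block : V(T̂) → V(T) send each vertex to its block. Inside a block the arcs are
-- transitive, so the two top vertices of a block among any set of vertices are covertices of
-- the subtournament they induce, and deleting a pair of covertices leaves the determinant of
-- a skew-adjacency matrix unchanged. Hence every induced subtournament of T̂ has the
-- determinant of one of T, and conversely T is induced in T̂ by one vertex per block; so T
-- and T̂ lie in the same classes D_k. Extending T by u with σ is mirrored by extending T̂ by u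
-- with σ ∘ block, which is again a blowup, and a CR vertex of the latter projects to one of
-- the former. Sizes only drop (|T| ≤ |T̂|), and a diamond T̂ forces |T| = 4: otherwise
-- |T| ≤ 3, so T ∈ D_1, whereas a diamond has determinant 9.
module Submission where

open import Defs
open import Data.Nat as ℕ using (ℕ; zero; suc; _≤_; z≤n; s≤s)
import Data.Nat.Properties as ℕP
open import Data.Integer as ℤ using (ℤ; +_; -_; _+_; _*_; _-_)
import Data.Integer.Properties as ℤP
open import Data.Integer.Tactic.RingSolver using (solve-∀)
open import Data.Fin as Fin using (Fin; zero; suc; punchIn; punchOut; toℕ; inject₁; _≟_)
open import Data.Fin.Properties as FinP using (toℕ-inject₁; any?; <-cmp)
open import Data.Fin.Induction using (<-weakInduction)
open import Data.Vec.Functional using (_∷_; [])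
open import Data.Bool using (Bool; true; false; not; if_then_else_)
open import Data.Empty using (⊥-elim)
open import Data.Sum using (_⊎_; inj₁; inj₂; [_,_])
import Data.Sum as Sum
open import Data.Product using (Σ; ∃; ∃₂; _×_; _,_; proj₁; proj₂)
open import Function using (_∘_; _$_; id)
open import Function.Definitions using (Injective)
open import Relation.Binary.Definitions using (tri<; tri≈; tri>)
open import Relation.Binary.PropositionalEquality
  using (_≡_; _≢_; refl; sym; trans; cong; cong₂; subst; module ≡-Reasoning)
open import Relation.Nullary using (¬_; Dec; yes; no)
open import Relation.Nullary.Decidable using (_×-dec_; ¬?)
open import Relation.Unary using (Decidable)

-- Determinants

sumFin-cong : ∀ {n} {f g : Fin n → ℤ} → (∀ i → f i ≡ g i) → sumFin f ≡ sumFin g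
sumFin-cong {zero}  f≗g = refl
sumFin-cong {suc n} f≗g = cong₂ _+_ (f≗g zero) (sumFin-cong (f≗g ∘ suc))

sumFin-zero : ∀ {n} {f : Fin n → ℤ} → (∀ i → f i ≡ + 0) → sumFin f ≡ + 0
sumFin-zero {zero}  f≗0 = refl
sumFin-zero {suc n} f≗0 = cong₂ _+_ (f≗0 zero) (sumFin-zero (f≗0 ∘ suc))

sumFin-+ : ∀ {n} (f g : Fin n → ℤ) → sumFin (λ i → f i + g i) ≡ sumFin f + sumFin g
sumFin-+ {zero}  f g = refl
sumFin-+ {suc n} f g =
  trans (cong (_+_ (f zero + g zero)) (sumFin-+ (f ∘ suc) (g ∘ suc)))
        (interchange (f zero) (g zero) (sumFin (f ∘ suc)) (sumFin (g ∘ suc)))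
  where
  interchange : ∀ a b c d → a + b + (c + d) ≡ a + c + (b + d)
  interchange = solve-∀

sumFin-*ˡ : ∀ {n} (c : ℤ) (f : Fin n → ℤ) → sumFin (λ i → c * f i) ≡ c * sumFin f
sumFin-*ˡ {zero}  c f = sym (ℤP.*-zeroʳ c)
sumFin-*ˡ {suc n} c f =
  trans (cong (_+_ (c * f zero)) (sumFin-*ˡ c (f ∘ suc))) (sym (ℤP.*-distribˡ-+ c _ _))

sumFin-neg : ∀ {n} (f : Fin n → ℤ) → sumFin (λ i → - f i) ≡ - sumFin f
sumFin-neg {zero}  f = refl
sumFin-neg {suc n} f =
  trans (cong (_+_ (- f zero)) (sumFin-neg (f ∘ suc))) (sym (ℤP.neg-distrib-+ (f zero) _))

sumFin-comm : ∀ {m n} (F : Fin m → Fin n → ℤ) →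
  sumFin (λ i → sumFin (F i)) ≡ sumFin (λ j → sumFin (λ i → F i j))
sumFin-comm {zero} {n} F = sym (sumFin-zero {n} (λ _ → refl))
sumFin-comm {suc m} F =
  trans (cong (_+_ (sumFin (F zero))) (sumFin-comm (F ∘ suc))) (sym (sumFin-+ (F zero) _))

Matrix : ℕ → Set
Matrix n = Fin n → Fin n → ℤ

det-cong : ∀ {n} {M N : Matrix n} → (∀ i j → M i j ≡ N i j) → det M ≡ det N
det-cong {zero}  M≗N = refl
det-cong {suc n} M≗N = sumFin-cong λ j →
  cong₂ (λ x y → sign (toℕ j) * x * y) (M≗N zero j) (det-cong (λ r c → M≗N (suc r) (punchIn j c)))

det-expand-col₀ : ∀ {n} (M : Matrix (suc n)) →
  det M ≡ sumFin (λ r → sign (toℕ r) * M r zero * det (λ r′ c′ → M (punchIn r r′) (suc c′)))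
det-expand-col₀ {zero}  M = refl
det-expand-col₀ {suc n} M = cong (_+_ (sign 0 * M zero zero * det (λ r c → M (suc r) (suc c)))) (begin
    sumFin (λ j → - s j * M zero (suc j) * det (λ r c → M (suc r) (punchIn (suc j) c)))
      ≡⟨ sumFin-cong (λ j → cong (- s j * M zero (suc j) *_)
                                 (det-expand-col₀ (λ r c → M (suc r) (punchIn (suc j) c)))) ⟩
    sumFin (λ j → - s j * M zero (suc j) * sumFin (λ r → s r * M (suc r) zero * X j r))
      ≡⟨ sumFin-cong (λ j → sym (sumFin-*ˡ (- s j * M zero (suc j))
                                            (λ r → s r * M (suc r) zero * X j r))) ⟩
    sumFin (λ j → sumFin (λ r → - s j * M zero (suc j) * (s r * M (suc r) zero * X j r)))
      ≡⟨ sumFin-cong (λ j → sumFin-cong (λ r →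
           exchange (s j) (M zero (suc j)) (s r) (M (suc r) zero) (X j r))) ⟩
    sumFin (λ j → sumFin (λ r → - s r * M (suc r) zero * (s j * M zero (suc j) * X j r)))
      ≡⟨ sumFin-comm (λ j r → - s r * M (suc r) zero * (s j * M zero (suc j) * X j r)) ⟩
    sumFin (λ r → sumFin (λ j → - s r * M (suc r) zero * (s j * M zero (suc j) * X j r)))
      ≡⟨ sumFin-cong (λ r → sumFin-*ˡ (- s r * M (suc r) zero) (λ j → s j * M zero (suc j) * X j r)) ⟩
    sumFin (λ r → - s r * M (suc r) zero * det (λ r′ c′ → M (punchIn (suc r) r′) (suc c′))) ∎)
  where
  open ≡-Reasoning
  s : Fin (suc n) → ℤ
  s i = sign (toℕ i)
  X : Fin (suc n) → Fin (suc n) → ℤ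
  X j r = det (λ r′ c′ → M (suc (punchIn r r′)) (suc (punchIn j c′)))
  exchange : ∀ sj mj sr mr x → - sj * mj * (sr * mr * x) ≡ - sr * mr * (sj * mj * x)
  exchange = solve-∀

det-transpose : ∀ {n} (M : Matrix n) → det (λ r c → M c r) ≡ det M
det-transpose {zero}  M = refl
det-transpose {suc n} M = trans
  (sumFin-cong (λ j → cong (sign (toℕ j) * M j zero *_) (det-transpose (λ r c → M (punchIn j r) (suc c)))))
  (sym (det-expand-col₀ M))

adjSwap : ∀ {m} → Fin m → Fin (suc m) → Fin (suc m)
adjSwap zero    zero          = suc zero
adjSwap zero    (suc zero)    = zero
adjSwap zero    (suc (suc c)) = suc (suc c)
adjSwap (suc k) zero          = zero
adjSwap (suc k) (suc c)       = suc (adjSwap k c)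

adjSwap-inject₁ : ∀ {m} (k : Fin m) → adjSwap k (inject₁ k) ≡ suc k
adjSwap-inject₁ zero    = refl
adjSwap-inject₁ (suc k) = cong suc (adjSwap-inject₁ k)

adjSwap-suc : ∀ {m} (k : Fin m) → adjSwap k (suc k) ≡ inject₁ k
adjSwap-suc zero    = refl
adjSwap-suc (suc k) = cong suc (adjSwap-suc k)

adjSwap-punchIn-suc : ∀ {m} (k : Fin m) c → adjSwap k (punchIn (suc k) c) ≡ punchIn (inject₁ k) c
adjSwap-punchIn-suc zero    zero    = refl
adjSwap-punchIn-suc zero    (suc c) = refl
adjSwap-punchIn-suc (suc k) zero    = refl
adjSwap-punchIn-suc (suc k) (suc c) = cong suc (adjSwap-punchIn-suc k c)

adjSwap-punchIn-inject₁ : ∀ {m} (k : Fin m) c → adjSwap k (punchIn (inject₁ k) c) ≡ punchIn (suc k) c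
adjSwap-punchIn-inject₁ zero    zero    = refl
adjSwap-punchIn-inject₁ zero    (suc c) = refl
adjSwap-punchIn-inject₁ (suc k) zero    = refl
adjSwap-punchIn-inject₁ (suc k) (suc c) = cong suc (adjSwap-punchIn-inject₁ k c)

adjSwap-view : ∀ {m} (k : Fin (suc m)) (j : Fin (suc (suc m))) →
  j ≡ inject₁ k ⊎ j ≡ suc k ⊎
  (adjSwap k j ≡ j × Σ (Fin m) λ k′ → ∀ c → adjSwap k (punchIn j c) ≡ punchIn j (adjSwap k′ c))
adjSwap-view zero    zero       = inj₁ refl
adjSwap-view zero    (suc zero) = inj₂ (inj₁ refl)
adjSwap-view {suc m} zero (suc (suc j)) =
  inj₂ (inj₂ (refl , zero , λ { zero → refl ; (suc zero) → refl ; (suc (suc c)) → refl }))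
adjSwap-view (suc k) zero = inj₂ (inj₂ (refl , k , λ c → refl))
adjSwap-view {suc m} (suc k) (suc j) with adjSwap-view k j
... | inj₁ j≡k         = inj₁ (cong suc j≡k)
... | inj₂ (inj₁ j≡k+1) = inj₂ (inj₁ (cong suc j≡k+1))
... | inj₂ (inj₂ (fix , k′ , comm)) =
  inj₂ (inj₂ (cong suc fix , suc k′ , λ { zero → refl ; (suc c) → cong suc (comm c) }))

sumFin-adjSwap : ∀ {m} (k : Fin m) (F : Fin (suc m) → ℤ) → sumFin (F ∘ adjSwap k) ≡ sumFin F
sumFin-adjSwap {suc m} zero F = swap₂ (F (suc zero)) (F zero) (sumFin (λ c → F (suc (suc c))))
  where
  swap₂ : ∀ a b c → a + (b + c) ≡ b + (a + c)
  swap₂ = solve-∀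
sumFin-adjSwap (suc k) F = cong (_+_ (F zero)) (sumFin-adjSwap k (F ∘ suc))

-- Expand along row 0 and reindex the sum by the swap: the terms for the two swapped columns
-- trade places with opposite signs, and every other minor changes sign by induction.
det-swapCols : ∀ {m} (k : Fin m) (M : Matrix (suc m)) → det (λ r c → M r (adjSwap k c)) ≡ - det M
det-swapCols {suc m} k M = begin
    sumFin H                 ≡⟨ sym (sumFin-adjSwap k H) ⟩
    sumFin (H ∘ adjSwap k)   ≡⟨ sumFin-cong term ⟩
    sumFin (λ j → - G j)     ≡⟨ sumFin-neg G ⟩
    - sumFin G               ∎
  where
  open ≡-Reasoning
  H G : Fin (suc (suc m)) → ℤ
  H j = sign (toℕ j) * M zero (adjSwap k j) * det (λ r c → M (suc r) (adjSwap k (punchIn j c)))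
  G j = sign (toℕ j) * M zero j * det (λ r c → M (suc r) (punchIn j c))
  negˡ : ∀ s x d → - s * x * d ≡ - (s * x * d)
  negˡ = solve-∀
  term : ∀ j → H (adjSwap k j) ≡ - G j
  term j with adjSwap-view k j
  ... | inj₁ refl rewrite adjSwap-inject₁ k | adjSwap-suc k | toℕ-inject₁ k =
    trans (cong (- sign (toℕ k) * M zero (inject₁ k) *_)
                (det-cong (λ r c → cong (M (suc r)) (adjSwap-punchIn-suc k c))))
          (negˡ (sign (toℕ k)) (M zero (inject₁ k)) _)
  ... | inj₂ (inj₁ refl) rewrite adjSwap-suc k | adjSwap-inject₁ k | toℕ-inject₁ k =
    trans (cong₂ (λ s d → s * M zero (suc k) * d) (sym (ℤP.neg-involutive (sign (toℕ k))))
                 (det-cong (λ r c → cong (M (suc r)) (adjSwap-punchIn-inject₁ k c))))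
          (negˡ (- sign (toℕ k)) (M zero (suc k)) _)
  ... | inj₂ (inj₂ (fix , k′ , comm)) rewrite fix | fix =  -- H (adjSwap k j) nests adjSwap k twice
    trans (cong (sign (toℕ j) * M zero j *_)
            (trans (det-cong (λ r c → cong (M (suc r)) (comm c)))
                   (det-swapCols k′ (λ r c → M (suc r) (punchIn j c)))))
          (sym (ℤP.neg-distribʳ-* (sign (toℕ j) * M zero j) _))

det-swapRows : ∀ {m} (k : Fin m) (M : Matrix (suc m)) → det (λ r c → M (adjSwap k r) c) ≡ - det M
det-swapRows k M = begin
  det (λ r c → M (adjSwap k r) c)  ≡⟨ sym (det-transpose (λ r c → M (adjSwap k r) c)) ⟩
  det (λ r c → M (adjSwap k c) r)  ≡⟨ det-swapCols k (λ r c → M c r) ⟩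
  - det (λ r c → M c r)            ≡⟨ cong -_ (det-transpose M) ⟩
  - det M                          ∎
  where open ≡-Reasoning

reindex : ∀ {m n} → (Fin m → Fin n) → Matrix n → Matrix m
reindex π M i j = M (π i) (π j)

det-reindex-adjSwap : ∀ {m} (k : Fin m) (M : Matrix (suc m)) → det (reindex (adjSwap k) M) ≡ det M
det-reindex-adjSwap k M = begin
  det (reindex (adjSwap k) M)         ≡⟨ det-swapCols k (λ r c → M (adjSwap k r) c) ⟩
  - det (λ r c → M (adjSwap k r) c)   ≡⟨ cong -_ (det-swapRows k M) ⟩
  - - det M                           ≡⟨ ℤP.neg-involutive (det M) ⟩
  det M                               ∎
  where open ≡-Reasoning

toFront : ∀ {m} → Fin (suc m) → Fin (suc m) → Fin (suc m)
toFront x zero    = x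
toFront x (suc c) = punchIn x c

toFront-injective : ∀ {m} (x : Fin (suc m)) → Injective _≡_ _≡_ (toFront x)
toFront-injective x {zero}  {zero}  _ = refl
toFront-injective x {zero}  {suc j} e = ⊥-elim (FinP.punchInᵢ≢i x j (sym e))
toFront-injective x {suc i} {zero}  e = ⊥-elim (FinP.punchInᵢ≢i x i e)
toFront-injective x {suc i} {suc j} e = cong suc (FinP.punchIn-injective x i j e)

toFront-suc : ∀ {m} (x : Fin m) c → toFront (suc x) c ≡ adjSwap x (toFront (inject₁ x) c)
toFront-suc x zero    = sym (adjSwap-inject₁ x)
toFront-suc x (suc c) = sym (adjSwap-punchIn-inject₁ x c)

det-reindex-toFront : ∀ {m} (x : Fin (suc m)) (M : Matrix (suc m)) → det (reindex (toFront x) M) ≡ det M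
det-reindex-toFront = <-weakInduction _ base step
  where
  base : ∀ M → det (reindex (toFront zero) M) ≡ det M
  base M = det-cong {M = reindex (toFront zero) M} {N = M} λ
    { zero zero → refl ; zero (suc c) → refl ; (suc r) zero → refl ; (suc r) (suc c) → refl }
  step : ∀ x → (∀ M → det (reindex (toFront (inject₁ x)) M) ≡ det M) →
         ∀ M → det (reindex (toFront (suc x)) M) ≡ det M
  step x ih M = trans (det-cong (λ r c → cong₂ M (toFront-suc x r) (toFront-suc x c)))
                      (trans (ih (reindex (adjSwap x) M)) (det-reindex-adjSwap x M))

det-linear-row₀ : ∀ {n} (u v : Fin (suc n) → ℤ) {w : Fin (suc n) → ℤ}
  (R : Fin n → Fin (suc n) → ℤ) →
  (∀ c → w c ≡ u c + v c) → det (w ∷ R) ≡ det (u ∷ R) + det (v ∷ R)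
det-linear-row₀ u v {w} R w≗u+v =
  trans (sumFin-cong term) (sumFin-+ (λ j → sign (toℕ j) * u j * D j) (λ j → sign (toℕ j) * v j * D j))
  where
  D : Fin _ → ℤ
  D j = det (λ r c → R r (punchIn j c))
  distrib : ∀ s a b d → s * (a + b) * d ≡ s * a * d + s * b * d
  distrib = solve-∀
  term : ∀ j → sign (toℕ j) * w j * D j ≡ sign (toℕ j) * u j * D j + sign (toℕ j) * v j * D j
  term j = trans (cong (λ x → sign (toℕ j) * x * D j) (w≗u+v j)) (distrib (sign (toℕ j)) (u j) (v j) (D j))

i≡-i⇒i≡0 : ∀ {i} → i ≡ - i → i ≡ + 0
i≡-i⇒i≡0 {ℤ.+0} _ = refl

det-equal-rows₀₁ : ∀ {n} (M : Matrix (suc (suc n))) → (∀ c → M zero c ≡ M (suc zero) c) → det M ≡ + 0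
det-equal-rows₀₁ M row₀≗row₁ = i≡-i⇒i≡0 (trans (sym (det-cong swapped)) (det-swapRows zero M))
  where
  swapped : ∀ r c → M (adjSwap zero r) c ≡ M r c
  swapped zero          c = sym (row₀≗row₁ c)
  swapped (suc zero)    c = row₀≗row₁ c
  swapped (suc (suc r)) c = refl

Skew : ∀ {n} → Matrix n → Set
Skew M = ∀ i j → M j i ≡ - M i j

module SkewPair {n} (M : Matrix (suc (suc n))) (skew : Skew M)
                (rows : ∀ c → M zero (suc (suc c)) ≡ M (suc zero) (suc (suc c))) where
  s : ℤ
  s = M zero (suc zero)

  corner : Matrix n
  corner r c = M (suc (suc r)) (suc (suc c))

  minor : Fin (suc (suc n)) → ℤ
  minor j = det (λ r c → M (suc r) (punchIn j c))

  diag : ∀ i → M i i ≡ + 0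
  diag i = i≡-i⇒i≡0 (skew i i)

  columns : ∀ r → M (suc (suc r)) (suc zero) ≡ M (suc (suc r)) zero
  columns r = trans (skew (suc zero) (suc (suc r))) (trans (cong -_ (sym (rows r))) (sym (skew zero (suc (suc r)))))

  -- Subtracting row 1 from row 0 leaves the row (s, s, 0, …, 0).
  det-via-minors : det M ≡ s * (minor zero - minor (suc zero))
  det-via-minors = begin
    det M
      ≡⟨ det-linear-row₀ d (M (suc zero)) (M ∘ suc) (λ c → sym (minus-plus (M zero c) (M (suc zero) c))) ⟩
    det (d ∷ M ∘ suc) + det (M (suc zero) ∷ M ∘ suc)
      ≡⟨ cong (_+_ (det (d ∷ M ∘ suc))) (det-equal-rows₀₁ (M (suc zero) ∷ M ∘ suc) (λ c → refl)) ⟩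
    det (d ∷ M ∘ suc) + + 0
      ≡⟨ ℤP.+-identityʳ _ ⟩
    sign 0 * d zero * minor zero + (sign 1 * d (suc zero) * minor (suc zero) + sumFin rest)
      ≡⟨ cong₂ (λ x y → sign 0 * x * minor zero + (sign 1 * y * minor (suc zero) + sumFin rest)) d₀ d₁ ⟩
    + 1 * s * minor zero + (- + 1 * s * minor (suc zero) + sumFin rest)
      ≡⟨ cong (λ z → + 1 * s * minor zero + (- + 1 * s * minor (suc zero) + z)) (sumFin-zero rest≡0) ⟩
    + 1 * s * minor zero + (- + 1 * s * minor (suc zero) + + 0)
      ≡⟨ collect s (minor zero) (minor (suc zero)) ⟩
    s * (minor zero - minor (suc zero)) ∎
    where
    open ≡-Reasoning
    d : Fin (suc (suc n)) → ℤ
    d c = M zero c - M (suc zero) c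
    rest : Fin n → ℤ
    rest c = sign (toℕ (suc (suc c))) * d (suc (suc c)) * minor (suc (suc c))
    minus-plus : ∀ a b → a - b + b ≡ a
    minus-plus = solve-∀
    zero-minus-neg : ∀ x → + 0 - - x ≡ x
    zero-minus-neg = solve-∀
    annihilate : ∀ a b → a * + 0 * b ≡ + 0
    annihilate = solve-∀
    collect : ∀ s x y → + 1 * s * x + (- + 1 * s * y + + 0) ≡ s * (x - y)
    collect = solve-∀
    d₀ : d zero ≡ s
    d₀ = trans (cong₂ _-_ (diag zero) (skew zero (suc zero))) (zero-minus-neg s)
    d₁ : d (suc zero) ≡ s
    d₁ = trans (cong (_-_ s) (diag (suc zero))) (ℤP.+-identityʳ s)
    rest≡0 : ∀ c → rest c ≡ + 0
    rest≡0 c = trans (cong (λ x → sign (toℕ (suc (suc c))) * x * minor (suc (suc c)))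
                           (trans (cong (_-_ (M zero (suc (suc c)))) (sym (rows c)))
                                  (ℤP.+-inverseʳ (M zero (suc (suc c))))))
                     (annihilate (sign (toℕ (suc (suc c)))) (minor (suc (suc c))))

  -- The two minors differ only in column 0, by (s, 0, …, 0).
  minor-difference : minor zero - minor (suc zero) ≡ s * det corner
  minor-difference = begin
    minor zero - minor (suc zero)
      ≡⟨ cong₂ _-_ (det-expand-col₀ (λ r c → M (suc r) (suc c)))
                   (det-expand-col₀ (λ r c → M (suc r) (punchIn (suc zero) c))) ⟩
    sumFin P - sumFin Q
      ≡⟨ cong (_+_ (sumFin P)) (sumFin-neg Q) ⟨
    sumFin P + sumFin (λ r → - Q r)
      ≡⟨ sumFin-+ P (λ r → - Q r) ⟨
    (P zero - Q zero) + sumFin (λ r → P (suc r) - Q (suc r))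
      ≡⟨ cong₂ _+_ leading (sumFin-zero cancel) ⟩
    s * det corner + + 0
      ≡⟨ ℤP.+-identityʳ (s * det corner) ⟩
    s * det corner ∎
    where
    open ≡-Reasoning
    F : Fin (suc n) → ℤ
    F r = det (λ r′ c′ → M (suc (punchIn r r′)) (suc (suc c′)))
    P Q : Fin (suc n) → ℤ
    P r = sign (toℕ r) * M (suc r) (suc zero) * F r
    Q r = sign (toℕ r) * M (suc r) zero * F r
    expand : ∀ s e → + 1 * + 0 * e - + 1 * (- s) * e ≡ s * e
    expand = solve-∀
    leading : P zero - Q zero ≡ s * det corner
    leading = trans (cong₂ (λ x y → + 1 * x * det corner - + 1 * y * det corner)
                           (diag (suc zero)) (skew zero (suc zero)))
                    (expand s (det corner))
    cancel : ∀ r → P (suc r) - Q (suc r) ≡ + 0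
    cancel r = trans (cong (λ x → P (suc r) - sign (toℕ (suc r)) * x * F (suc r)) (sym (columns r)))
                     (ℤP.+-inverseʳ (P (suc r)))

det-skew-pair : ∀ {n} (M : Matrix (suc (suc n))) → Skew M →
  M zero (suc zero) * M zero (suc zero) ≡ + 1 →
  (∀ c → M zero (suc (suc c)) ≡ M (suc zero) (suc (suc c))) →
  det M ≡ det (λ r c → M (suc (suc r)) (suc (suc c)))
det-skew-pair M skew s²≡1 rows = begin
  det M                                ≡⟨ det-via-minors ⟩
  s * (minor zero - minor (suc zero))  ≡⟨ cong (s *_) minor-difference ⟩
  s * (s * det corner)                 ≡⟨ ℤP.*-assoc s s (det corner) ⟨
  s * s * det corner                   ≡⟨ cong (_* det corner) s²≡1 ⟩
  + 1 * det corner                     ≡⟨ ℤP.*-identityˡ (det corner) ⟩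
  det corner                           ∎
  where
  open ≡-Reasoning
  open SkewPair M skew rows

module _ {n} (T : Tournament n) where

  θ-cong : ∀ {n′} (T′ : Tournament n′) {u v u′ v′} →
           arc T u v ≡ arc T′ u′ v′ → θ T u v ≡ θ T′ u′ v′
  θ-cong T′ = cong (λ b → if b then + 1 else - (+ 1))

  S-diag : ∀ u → S T u u ≡ + 0
  S-diag u with u ≟ u
  ... | yes _  = refl
  ... | no u≢u = ⊥-elim (u≢u refl)

  S-off : ∀ {u v} → u ≢ v → S T u v ≡ θ T u v
  S-off {u} {v} u≢v with u ≟ v
  ... | yes u≡v = ⊥-elim (u≢v u≡v)
  ... | no _    = refl

  θ-skew : ∀ {u v} → u ≢ v → θ T v u ≡ - θ T u v
  θ-skew {u} {v} u≢v rewrite tourn T u v u≢v with arc T u v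
  ... | true  = refl
  ... | false = refl

  θ² : ∀ u v → θ T u v * θ T u v ≡ + 1
  θ² u v with arc T u v
  ... | true  = refl
  ... | false = refl

  S-skew : Skew (S T)
  S-skew u v with u ≟ v
  ... | yes refl = S-diag u
  ... | no u≢v   = trans (S-off (u≢v ∘ sym)) (θ-skew u≢v)

  arc-total : ∀ {u v} → u ≢ v → arc T u v ≡ true ⊎ arc T v u ≡ true
  arc-total {u} {v} u≢v with arc T u v in uv
  ... | true  = inj₁ refl
  ... | false = inj₂ (trans (tourn T u v u≢v) (cong not uv))

reindex-S-cong : ∀ {m n n′} (T : Tournament n) (T′ : Tournament n′)
  {f : Fin m → Fin n} {g : Fin m → Fin n′} →
  Injective _≡_ _≡_ f → Injective _≡_ _≡_ g →
  (∀ i j → i ≢ j → arc T (f i) (f j) ≡ arc T′ (g i) (g j)) →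
  ∀ i j → reindex f (S T) i j ≡ reindex g (S T′) i j
reindex-S-cong T T′ {f} {g} f-inj g-inj arcs i j with i ≟ j
... | yes refl = trans (S-diag T (f i)) (sym (S-diag T′ (g i)))
... | no i≢j   =
  trans (S-off T (i≢j ∘ f-inj)) (trans (θ-cong T T′ (arcs i j i≢j)) (sym (S-off T′ (i≢j ∘ g-inj))))

-- Lists x, y first and then the remaining indices in increasing order.
pairFront : ∀ {m} {x y : Fin (suc (suc m))} → x ≢ y → Fin (suc (suc m)) → Fin (suc (suc m))
pairFront {y = y} x≢y = toFront y ∘ toFront (suc (punchOut (x≢y ∘ sym)))

pairFront-zero : ∀ {m} {x y : Fin (suc (suc m))} (x≢y : x ≢ y) → pairFront x≢y zero ≡ x
pairFront-zero x≢y = FinP.punchIn-punchOut (x≢y ∘ sym)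

pairFront-injective : ∀ {m} {x y : Fin (suc (suc m))} (x≢y : x ≢ y) → Injective _≡_ _≡_ (pairFront x≢y)
pairFront-injective {y = y} x≢y = toFront-injective _ ∘ toFront-injective y

dropPair : ∀ {m} {x y : Fin (suc (suc m))} → x ≢ y → Fin m → Fin (suc (suc m))
dropPair x≢y c = pairFront x≢y (suc (suc c))

det-reindex-pairFront : ∀ {m} {x y : Fin (suc (suc m))} (x≢y : x ≢ y) (M : Matrix (suc (suc m))) →
  det (reindex (pairFront x≢y) M) ≡ det M
det-reindex-pairFront {y = y} x≢y M =
  trans (det-reindex-toFront _ (reindex (toFront y) M)) (det-reindex-toFront y M)

det-covertices : ∀ {N m} (T : Tournament N) (f : Fin (suc (suc m)) → Fin N) → Injective _≡_ _≡_ f →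
  ∀ {x y} (x≢y : x ≢ y) → (∀ z → z ≢ x → z ≢ y → arc T (f x) (f z) ≡ arc T (f y) (f z)) →
  det (reindex f (S T)) ≡ det (reindex (f ∘ dropPair x≢y) (S T))
det-covertices {m = m} T f f-inj {x} {y} x≢y cov =
  trans (sym (det-reindex-pairFront x≢y (reindex f (S T))))
        (det-skew-pair (reindex (f ∘ π) (S T)) (λ i j → S-skew T (f (π i)) (f (π j))) unit rows)
  where
  π : Fin (suc (suc m)) → Fin (suc (suc m))
  π = pairFront x≢y
  fx≢fy : f x ≢ f y
  fx≢fy = x≢y ∘ f-inj
  unit : S T (f (π zero)) (f y) * S T (f (π zero)) (f y) ≡ + 1
  unit rewrite pairFront-zero x≢y | S-off T fx≢fy = θ² T (f x) (f y)
  rows : ∀ c → S T (f (π zero)) (f (π (suc (suc c)))) ≡ S T (f y) (f (π (suc (suc c))))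
  rows c rewrite pairFront-zero x≢y =
    trans (S-off T (z≢x ∘ sym ∘ f-inj))
          (trans (θ-cong T T (cov z z≢x z≢y)) (sym (S-off T (z≢y ∘ sym ∘ f-inj))))
    where
    z : Fin (suc (suc m))
    z = π (suc (suc c))
    z≢x : z ≢ x
    z≢x z≡x with pairFront-injective x≢y {suc (suc c)} {zero} (trans z≡x (sym (pairFront-zero x≢y)))
    ... | ()
    z≢y : z ≢ y
    z≢y z≡y with pairFront-injective x≢y {suc (suc c)} {suc zero} z≡y
    ... | ()

-- Determinants of induced subtournaments of a blowup

record InducedDet {n} (T : Tournament n) (d : ℤ) : Set where
  constructor induced
  field
    {size}    : ℕ
    vertices  : Fin size → Fin n
    injective : Injective _≡_ _≡_ vertices
    det≡      : det (reindex vertices (S T)) ≡ d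

InD-⊆ : ∀ {n n′} {T : Tournament n} {T′ : Tournament n′} →
  (∀ {d} → InducedDet T′ d → InducedDet T d) → ∀ t → InD t T → InD t T′
InD-⊆ T′⊆T (suc t) T∈D m f f-inj with T′⊆T (induced f f-inj refl)
... | induced g g-inj det≡ = subst (ℤ._≤ _) det≡ (T∈D _ g g-inj)

IsSource : ∀ {m} → (Fin m → Set) → (Fin m → Fin m → Set) → Fin m → Set
IsSource P _⇝_ x = P x × (∀ l → P l → l ≢ x → x ⇝ l)

source? : ∀ {m} {P : Fin m → Set} {_⇝_ : Fin m → Fin m → Set} → Decidable P →
  (∀ {k l q} → P k → P l → P q → k ⇝ l → l ⇝ q → k ⇝ q) →
  (∀ {k l} → P k → P l → k ≢ l → k ⇝ l ⊎ l ⇝ k) →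
  (∀ k → ¬ P k) ⊎ ∃ (IsSource P _⇝_)
source? {zero} _ _ _ = inj₁ λ ()
source? {suc m} {P} {_⇝_} P? ⇝-trans ⇝-total
  with source? {P = P ∘ suc} {λ k l → suc k ⇝ suc l} (P? ∘ suc) ⇝-trans
               (λ pk pl k≢l → ⇝-total pk pl (k≢l ∘ FinP.suc-injective))
     | P? zero
... | inj₁ none | no ¬p₀ = inj₁ λ { zero → ¬p₀ ; (suc k) → none k }
... | inj₁ none | yes p₀ =
  inj₂ (zero , p₀ , λ { zero _ l≢0 → ⊥-elim (l≢0 refl) ; (suc l) pl _ → ⊥-elim (none l pl) })
... | inj₂ (x , px , x-src) | no ¬p₀ =
  inj₂ (suc x , px , λ { zero p₀ _ → ⊥-elim (¬p₀ p₀)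
                      ; (suc l) pl l≢x → x-src l pl (l≢x ∘ cong suc) })
... | inj₂ (x , px , x-src) | yes p₀ with ⇝-total p₀ px (λ ())
...   | inj₂ x⇝0 =
  inj₂ (suc x , px , λ { zero _ _ → x⇝0 ; (suc l) pl l≢x → x-src l pl (l≢x ∘ cong suc) })
...   | inj₁ 0⇝x = inj₂ (zero , p₀ , beats)
  where
  beats : ∀ l → P l → l ≢ zero → zero ⇝ l
  beats zero    _  l≢0 = ⊥-elim (l≢0 refl)
  beats (suc l) pl _ with l ≟ x
  ... | yes refl = 0⇝x
  ... | no l≢x   = ⇝-trans p₀ px pl 0⇝x (x-src l pl l≢x)

source : ∀ {m} {P : Fin m → Set} {_⇝_ : Fin m → Fin m → Set} → Decidable P →
  (∀ {k l q} → P k → P l → P q → k ⇝ l → l ⇝ q → k ⇝ q) →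
  (∀ {k l} → P k → P l → k ≢ l → k ⇝ l ⊎ l ⇝ k) →
  ∀ {k} → P k → ∃ (IsSource P _⇝_)
source P? ⇝-trans ⇝-total {k} pk with source? P? ⇝-trans ⇝-total
... | inj₁ none = ⊥-elim (none k pk)
... | inj₂ src  = src

-- T̂ is a transitive blowup of T in which blocks may be empty; unlike IsTransitiveBlowup,
-- this survives adding one vertex to both tournaments.
record BlowupMap {n N} (T : Tournament n) (T̂ : Tournament N) : Set where
  field
    block        : Fin N → Fin n
    arc-between  : ∀ x y → block x ≢ block y → arc T̂ x y ≡ arc T (block x) (block y)
    trans-within : ∀ x y z → block x ≡ block y → block y ≡ block z →
                   arc T̂ x y ≡ true → arc T̂ y z ≡ true → arc T̂ x z ≡ true

module _ {n N} {T : Tournament n} {T̂ : Tournament N} (B : BlowupMap T T̂) where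
  open BlowupMap B

  Collision : ∀ {m} → (Fin m → Fin N) → Set
  Collision f = ∃₂ λ i j → i ≢ j × block (f i) ≡ block (f j)

  collision? : ∀ {m} (f : Fin m → Fin N) → Dec (Collision f)
  collision? f = any? λ i → any? λ j → ¬? (i ≟ j) ×-dec (block (f i) ≟ block (f j))

  -- The two top vertices of a block, in its transitive order, are covertices.
  covertices : ∀ {m} (f : Fin m → Fin N) → Injective _≡_ _≡_ f → Collision f →
    ∃₂ λ x y → x ≢ y × (∀ z → z ≢ x → z ≢ y → arc T̂ (f x) (f z) ≡ arc T̂ (f y) (f z))
  covertices {m} f f-inj (i , j , i≢j , same) = x , y , y≢x ∘ sym , agree
    where
    InBlock : Fin m → Set
    InBlock k = block (f k) ≡ block (f i)
    _⇝_ : Fin m → Fin m → Set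
    k ⇝ l = arc T̂ (f k) (f l) ≡ true
    ⇝-trans : ∀ {Q : Fin m → Set} → (∀ {k} → Q k → InBlock k) →
              ∀ {k l q} → Q k → Q l → Q q → k ⇝ l → l ⇝ q → k ⇝ q
    ⇝-trans inB {k} {l} {q} qk ql qq =
      trans-within (f k) (f l) (f q) (trans (inB qk) (sym (inB ql))) (trans (inB ql) (sym (inB qq)))
    ⇝-total : ∀ {Q : Fin m → Set} {k l} → Q k → Q l → k ≢ l → k ⇝ l ⊎ l ⇝ k
    ⇝-total _ _ k≢l = arc-total T̂ (k≢l ∘ f-inj)
    top : ∃ (IsSource InBlock _⇝_)
    top = source (λ k → block (f k) ≟ block (f i)) (⇝-trans id) ⇝-total refl
    x : Fin m
    x = proj₁ top
    Rest : Fin m → Set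
    Rest k = InBlock k × k ≢ x
    another : ∃ Rest
    another with i ≟ x
    ... | yes i≡x = j , sym same , λ j≡x → i≢j (trans i≡x (sym j≡x))
    ... | no i≢x   = i , refl , i≢x
    next : ∃ (IsSource Rest _⇝_)
    next = source (λ k → (block (f k) ≟ block (f i)) ×-dec ¬? (k ≟ x))
                  (⇝-trans proj₁) ⇝-total (proj₂ another)
    y : Fin m
    y = proj₁ next
    y≢x : y ≢ x
    y≢x = proj₂ (proj₁ (proj₂ next))
    agree : ∀ z → z ≢ x → z ≢ y → arc T̂ (f x) (f z) ≡ arc T̂ (f y) (f z)
    agree z z≢x z≢y with block (f z) ≟ block (f i)
    ... | yes inB = trans (proj₂ (proj₂ top) z inB z≢x) (sym (proj₂ (proj₂ next) z (inB , z≢x) z≢y))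
    ... | no ¬inB = begin
      arc T̂ (f x) (f z)                 ≡⟨ arc-between (f x) (f z) (¬inB ∘ sym ∘ trans (sym x∈B)) ⟩
      arc T (block (f x)) (block (f z)) ≡⟨ cong (λ b → arc T b (block (f z))) (trans x∈B (sym y∈B)) ⟩
      arc T (block (f y)) (block (f z)) ≡⟨ arc-between (f y) (f z) (¬inB ∘ sym ∘ trans (sym y∈B)) ⟨
      arc T̂ (f y) (f z)                 ∎
      where
      open ≡-Reasoning
      x∈B : InBlock x
      x∈B = proj₁ (proj₂ top)
      y∈B : InBlock y
      y∈B = proj₁ (proj₁ (proj₂ next))

  inducedDet-down : ∀ m (f : Fin m → Fin N) → Injective _≡_ _≡_ f → InducedDet T (det (reindex f (S T̂)))
  inducedDet-down m f f-inj with collision? f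
  ... | no ¬c = induced (block ∘ f) block∘f-inj $
                det-cong (reindex-S-cong T T̂ block∘f-inj f-inj
                            (λ i j i≢j → sym (arc-between (f i) (f j) (i≢j ∘ block∘f-inj))))
    where
    block∘f-inj : Injective _≡_ _≡_ (block ∘ f)
    block∘f-inj {i} {j} eq with i ≟ j
    ... | yes i≡j = i≡j
    ... | no i≢j  = ⊥-elim (¬c (i , j , i≢j , eq))
  inducedDet-down (suc zero) f f-inj | yes (zero , zero , 0≢0 , _) = ⊥-elim (0≢0 refl)
  inducedDet-down (suc (suc m)) f f-inj | yes c with covertices f f-inj c
  ... | x , y , x≢y , agree =
    subst (InducedDet T) (sym (det-covertices T̂ f f-inj x≢y agree))
          (inducedDet-down m (f ∘ dropPair x≢y)
                           (FinP.suc-injective ∘ FinP.suc-injective ∘ pairFront-injective x≢y ∘ f-inj))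

  inducedDet-blowup : ∀ {d} → InducedDet T̂ d → InducedDet T d
  inducedDet-blowup (induced f f-inj refl) = inducedDet-down _ f f-inj

  blowupMap-ext : ∀ σ → BlowupMap (ext T σ) (ext T̂ (σ ∘ block))
  blowupMap-ext σ = record { block = block′ ; arc-between = between ; trans-within = within }
    where
    block′ : Fin (suc N) → Fin (suc n)
    block′ zero    = zero
    block′ (suc x) = suc (block x)
    between : ∀ x y → block′ x ≢ block′ y →
              extArc T̂ (σ ∘ block) x y ≡ extArc T σ (block′ x) (block′ y)
    between zero    zero    0≢0 = ⊥-elim (0≢0 refl)
    between zero    (suc y) _   = refl
    between (suc x) zero    _   = refl
    between (suc x) (suc y) x≢y = arc-between x y (x≢y ∘ cong suc)
    within : ∀ x y z → block′ x ≡ block′ y → block′ y ≡ block′ z →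
             extArc T̂ (σ ∘ block) x y ≡ true → extArc T̂ (σ ∘ block) y z ≡ true →
             extArc T̂ (σ ∘ block) x z ≡ true
    within zero    zero    _       _  _  () _
    within zero    (suc y) _       () _  _  _
    within (suc x) zero    _       () _  _  _
    within (suc x) (suc y) zero    _  () _  _
    within (suc x) (suc y) (suc z) xy yz = trans-within x y z (FinP.suc-injective xy) (FinP.suc-injective yz)

blowupMap : ∀ {n N} {T : Tournament n} {a} {T̂ : Tournament N} → IsTransitiveBlowup T a T̂ → BlowupMap T T̂
blowupMap (p , _ , _ , _ , _ , between , within) =
  record { block = p ; arc-between = between ; trans-within = within }

section : ∀ {n N} {T : Tournament n} {a} {T̂ : Tournament N} (B : IsTransitiveBlowup T a T̂) →
  (∀ i → 1 ≤ a i) → Σ (Fin n → Fin N) λ ι → ∀ i → proj₁ B (ι i) ≡ i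
section (_ , e , _ , pe , _) a≥1 = (λ i → e i (Fin.fromℕ< (a≥1 i))) , (λ i → pe i _)

∷-injective : ∀ {m n} {x : Fin n} {f : Fin m → Fin n} →
  (∀ i → f i ≢ x) → Injective _≡_ _≡_ f → Injective _≡_ _≡_ (x ∷ f)
∷-injective fresh f-inj {zero}  {zero}  _  = refl
∷-injective fresh f-inj {zero}  {suc j} eq = ⊥-elim (fresh j (sym eq))
∷-injective fresh f-inj {suc i} {zero}  eq = ⊥-elim (fresh i eq)
∷-injective fresh f-inj {suc i} {suc j} eq = cong suc (f-inj eq)

injective⇒surjective : ∀ {m n} {f : Fin m → Fin n} → n ≤ m → Injective _≡_ _≡_ f →
  ∀ y → ∃ λ x → f x ≡ y
injective⇒surjective {f = f} n≤m f-inj y with any? (λ x → f x ≟ y)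
... | yes hit  = hit
... | no  miss =
  ⊥-elim (FinP.<⇒notInjective (s≤s n≤m) (∷-injective (λ i fi≡y → miss (i , fi≡y)) f-inj))

-- Small tournaments and diamonds

±1 : Bool → ℤ
±1 b = if b then + 1 else - (+ 1)

-- Only the entries A i j with i < j are read, so for m ≤ 4 the determinant normalises to a
-- closed expression in those finitely many Booleans.
tournamentMatrix : ∀ {m} → (Fin m → Fin m → Bool) → Matrix m
tournamentMatrix A i j with <-cmp i j
... | tri< _ _ _ = ±1 (A i j)
... | tri≈ _ _ _ = + 0
... | tri> _ _ _ = - ±1 (A j i)

reindex-S≡tournamentMatrix : ∀ {n m} (T : Tournament n) {g : Fin m → Fin n} → Injective _≡_ _≡_ g →
  ∀ i j → reindex g (S T) i j ≡ tournamentMatrix (λ k l → arc T (g k) (g l)) i j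
reindex-S≡tournamentMatrix T {g} g-inj i j with <-cmp i j
... | tri< _ i≢j _ = S-off T (i≢j ∘ g-inj)
... | tri≈ _ refl _ = S-diag T (g i)
... | tri> _ i≢j _ = trans (S-off T (i≢j ∘ g-inj)) (θ-skew T (i≢j ∘ sym ∘ g-inj))

upper₃ : Bool → Bool → Bool → Fin 3 → Fin 3 → Bool
upper₃ x₀₁ x₀₂ x₁₂ zero       (suc zero)       = x₀₁
upper₃ x₀₁ x₀₂ x₁₂ zero       (suc (suc zero)) = x₀₂
upper₃ x₀₁ x₀₂ x₁₂ (suc zero) (suc (suc zero)) = x₁₂
upper₃ _   _   _   _          _                = false

det-tournamentMatrix≤1 : ∀ {m} (A : Fin m → Fin m → Bool) → m ≤ 3 → det (tournamentMatrix A) ℤ.≤ + 1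
det-tournamentMatrix≤1 {0} A _ = ℤP.≤-refl
det-tournamentMatrix≤1 {1} A _ = ℤ.+≤+ z≤n
det-tournamentMatrix≤1 {2} A _ = ℤP.≤-reflexive (det₂ (A zero (suc zero)))
  where
  det₂ : ∀ x → det (tournamentMatrix {2} λ _ _ → x) ≡ + 1
  det₂ true  = refl
  det₂ false = refl
det-tournamentMatrix≤1 {3} A _ =
  subst (ℤ._≤ + 1)
        (sym (det₃ (A zero (suc zero)) (A zero (suc (suc zero))) (A (suc zero) (suc (suc zero)))))
        (ℤ.+≤+ z≤n)
  where
  det₃ : ∀ x₀₁ x₀₂ x₁₂ → det (tournamentMatrix (upper₃ x₀₁ x₀₂ x₁₂)) ≡ + 0
  det₃ true  true  true  = refl
  det₃ true  true  false = refl
  det₃ true  false true  = refl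
  det₃ true  false false = refl
  det₃ false true  true  = refl
  det₃ false true  false = refl
  det₃ false false true  = refl
  det₃ false false false = refl
det-tournamentMatrix≤1 {suc (suc (suc (suc _)))} A (s≤s (s≤s (s≤s ())))

InD₁-small : ∀ {n} (T : Tournament n) → n ≤ 3 → InD 1 T
InD₁-small T n≤3 m g g-inj =
  subst (ℤ._≤ + 1) (sym (det-cong (reindex-S≡tournamentMatrix T g-inj)))
        (det-tournamentMatrix≤1 _ (ℕP.≤-trans (FinP.injective⇒≤ g-inj) n≤3))

upper₄ : Bool → Bool → Bool → Bool → Bool → Bool → Fin 4 → Fin 4 → Bool
upper₄ x₀₁ _   _   _   _   _   zero             (suc zero)             = x₀₁
upper₄ _   x₀₂ _   _   _   _   zero             (suc (suc zero))       = x₀₂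
upper₄ _   _   x₀₃ _   _   _   zero             (suc (suc (suc zero))) = x₀₃
upper₄ _   _   _   x₁₂ _   _   (suc zero)       (suc (suc zero))       = x₁₂
upper₄ _   _   _   _   x₁₃ _   (suc zero)       (suc (suc (suc zero))) = x₁₃
upper₄ _   _   _   _   _   x₂₃ (suc (suc zero)) (suc (suc (suc zero))) = x₂₃
upper₄ _   _   _   _   _   _   _                _                      = false

det-diamondMatrix : ∀ {x₀₁ x₀₂ x₀₃ x₁₂ x₁₃ x₂₃} → x₀₁ ≡ true → x₀₂ ≡ false → x₁₂ ≡ true →
  x₀₃ ≡ x₁₃ → x₁₃ ≡ x₂₃ → det (tournamentMatrix (upper₄ x₀₁ x₀₂ x₀₃ x₁₂ x₁₃ x₂₃)) ≡ + 9
det-diamondMatrix {x₁₃ = true}  refl refl refl refl refl = refl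
det-diamondMatrix {x₁₃ = false} refl refl refl refl refl = refl

diamond-inducedDet : ∀ {n} (T : Tournament n) → IsDiamond T → InducedDet T (+ 9)
diamond-inducedDet {n} T (_ , a , b , c , d , (a≢b , b≢c , a≢c , d≢a , d≢b , d≢c) , (ab , bc , ca) , apex) =
  induced f f-inj $
  trans (det-cong (reindex-S≡tournamentMatrix T f-inj))
        (det-diamondMatrix ab (reversed (a≢c ∘ sym) ca) bc (proj₁ apexArcs) (proj₂ apexArcs))
  where
  f : Fin 4 → Fin n
  f = a ∷ b ∷ c ∷ d ∷ []
  f-inj : Injective _≡_ _≡_ f
  f-inj = ∷-injective {3} (λ { zero → a≢b ∘ sym ; (suc zero) → a≢c ∘ sym ; (suc (suc zero)) → d≢a })
         (∷-injective {2} (λ { zero → b≢c ∘ sym ; (suc zero) → d≢b })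
         (∷-injective {1} (λ { zero → d≢c })
         (∷-injective {0} (λ ()) (λ { {()} }))))
  reversed : ∀ {u v} → u ≢ v → arc T u v ≡ true → arc T v u ≡ false
  reversed {u} {v} u≢v uv = trans (tourn T u v u≢v) (cong not uv)
  apexArcs : arc T a d ≡ arc T b d × arc T b d ≡ arc T c d
  apexArcs =
    [ (λ (da , db , dc) → trans (reversed d≢a da) (sym (reversed d≢b db))
                        , trans (reversed d≢b db) (sym (reversed d≢c dc)))
    , (λ (ad , bd , cd) → trans ad (sym bd) , trans bd (sym cd)) ] apex

diamond-∉D₁ : ∀ {n} (R : Tournament n) → IsDiamond R → ¬ InD 1 R
diamond-∉D₁ R D R∈D₁ with diamond-inducedDet R D
... | induced f f-inj det≡9 = 9≰1 (subst (ℤ._≤ + 1) det≡9 (R∈D₁ _ f f-inj))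
  where
  9≰1 : ¬ (+ 9 ℤ.≤ + 1)
  9≰1 (ℤ.+≤+ (s≤s ()))

diamond-transfer : ∀ {n N} (T : Tournament n) (T̂ : Tournament N)
  (h : Fin N → Fin n) → Injective _≡_ _≡_ h →
  n ≡ 4 → (∀ u v → arc T̂ u v ≡ arc T (h u) (h v)) → IsDiamond T̂ → IsDiamond T
diamond-transfer T T̂ h h-inj n≡4 hom
  (_ , a , b , c , d , (a≢b , b≢c , a≢c , d≢a , d≢b , d≢c) , (ab , bc , ca) , apex) =
  n≡4 , h a , h b , h c , h d ,
  (a≢b ∘ h-inj , b≢c ∘ h-inj , a≢c ∘ h-inj , d≢a ∘ h-inj , d≢b ∘ h-inj , d≢c ∘ h-inj) ,
  (arc⇒ ab , arc⇒ bc , arc⇒ ca) ,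
  Sum.map (λ (da , db , dc) → arc⇒ da , arc⇒ db , arc⇒ dc)
          (λ (ad , bd , cd) → arc⇒ ad , arc⇒ bd , arc⇒ cd) apex
  where
  arc⇒ : ∀ {u v} → arc T̂ u v ≡ true → arc T (h u) (h v) ≡ true
  arc⇒ {u} {v} = trans (sym (hom u v))

-- CR tournaments

-- The condition on the other vertices in Covertices (F = id) and Revertices (F = -_).
Agree : ∀ {k} → (ℤ → ℤ) → Tournament k → Fin k → Fin k → Set
Agree F R u₁ u₂ = ∀ v → v ≢ u₁ → v ≢ u₂ → θ R u₁ v ≡ F (θ R u₂ v)

NonCRExtensionsLeave : ∀ {m} → ℕ → Tournament m → Set
NonCRExtensionsLeave t R = ∀ σ → ¬ CRVertex R σ → ¬ InD (suc t) (ext R σ)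

one-or-more : ∀ {n} → Fin n → n ≡ 1 ⊎ 2 ≤ n
one-or-more {suc zero}    _ = inj₁ refl
one-or-more {suc (suc _)} _ = inj₂ (s≤s (s≤s z≤n))

module _ {n N} {T : Tournament n} {T̂ : Tournament N} (B : BlowupMap T T̂)
         {ι : Fin n → Fin N} (block∘ι : ∀ i → BlowupMap.block B (ι i) ≡ i) where
  open BlowupMap B

  ι-injective : Injective _≡_ _≡_ ι
  ι-injective {i} {j} ιi≡ιj = trans (sym (block∘ι i)) (trans (cong block ιi≡ιj) (block∘ι j))

  n≤N : n ≤ N
  n≤N = FinP.injective⇒≤ ι-injective

  inhabited : 0 ℕ.< N → 0 ℕ.< n
  inhabited 0<N = ℕ.>-nonZero⁻¹ n {{FinP.nonZeroIndex (block (Fin.fromℕ< 0<N))}}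

  arc-ι : ∀ w i → block w ≢ i → arc T̂ w (ι i) ≡ arc T (block w) i
  arc-ι w i w≢i =
    trans (arc-between w (ι i) (λ e → w≢i (trans e (block∘ι i)))) (cong (arc T (block w)) (block∘ι i))

  inducedDet-section : ∀ {d} → InducedDet T d → InducedDet T̂ d
  inducedDet-section (induced g g-inj refl) =
    induced (ι ∘ g) (g-inj ∘ ι-injective) $ det-cong (reindex-S-cong T̂ T (g-inj ∘ ι-injective) g-inj arcs)
    where
    arcs : ∀ i j → i ≢ j → arc T̂ (ι (g i)) (ι (g j)) ≡ arc T (g i) (g j)
    arcs i j i≢j = trans (arc-ι (ι (g i)) (g j) (λ e → i≢j (g-inj (trans (sym (block∘ι (g i))) e))))
                         (cong (λ u → arc T u (g j)) (block∘ι (g i)))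

  agree-down : ∀ {F} σ w → Agree F (ext T̂ (σ ∘ block)) zero (suc w) →
                          Agree F (ext T σ) zero (suc (block w))
  agree-down σ w agree zero 0≢0 _ = ⊥-elim (0≢0 refl)
  agree-down {F} σ w agree (suc i) _ i≢w = begin
    θ (ext T σ) zero (suc i)
      ≡⟨ θ-cong (ext T σ) (ext T̂ (σ ∘ block)) {zero} {suc i} {zero} {suc (ι i)} (cong σ (sym (block∘ι i))) ⟩
    θ (ext T̂ (σ ∘ block)) zero (suc (ι i))
      ≡⟨ agree (suc (ι i)) (λ ()) (ιi≢w ∘ FinP.suc-injective) ⟩
    F (θ T̂ w (ι i))
      ≡⟨ cong F (θ-cong T̂ T (arc-ι w i (i≢w ∘ cong suc ∘ sym))) ⟩
    F (θ T (block w) i) ∎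
    where
    open ≡-Reasoning
    ιi≢w : ι i ≢ w
    ιi≢w e = i≢w (cong suc (trans (sym (block∘ι i)) (cong block e)))

  CRAssociated-down : ∀ σ w → CRAssociated (ext T̂ (σ ∘ block)) zero (suc w) →
                      CRAssociated (ext T σ) zero (suc (block w))
  CRAssociated-down σ w cr with one-or-more (block w)
  ... | inj₁ n≡1 = inj₁ (inj₁ (cong suc n≡1))
  ... | inj₂ 2≤n = Sum.map (lift {F = λ z → z}) (lift {F = -_}) cr
    where
    lift : ∀ {F} → suc N ≡ 2 ⊎ (3 ≤ suc N × Agree F (ext T̂ (σ ∘ block)) zero (suc w)) →
                   suc n ≡ 2 ⊎ (3 ≤ suc n × Agree F (ext T σ) zero (suc (block w)))
    lift (inj₁ N+1≡2)       = ⊥-elim (ℕP.≤⇒≯ (subst (n ≤_) (ℕP.suc-injective N+1≡2) n≤N) 2≤n)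
    lift {F} (inj₂ (_ , agree)) = inj₂ (s≤s 2≤n , agree-down {F} σ w agree)

  nonCRExtensionsLeave-down : ∀ t → NonCRExtensionsLeave t T̂ → NonCRExtensionsLeave t T
  nonCRExtensionsLeave-down t leave σ ¬cr T+u∈D =
    leave (σ ∘ block) (λ (w , cr) → ¬cr (block w , CRAssociated-down σ w cr))
          (InD-⊆ (inducedDet-blowup (blowupMap-ext B σ)) (suc t) T+u∈D)

  block-injective : N ≤ n → Injective _≡_ _≡_ block
  block-injective N≤n {u} {v} bu≡bv
    with injective⇒surjective N≤n ι-injective u | injective⇒surjective N≤n ι-injective v
  ... | i , refl | j , refl = cong ι (trans (sym (block∘ι i)) (trans bu≡bv (block∘ι j)))

  diamond-down : IsDiamond T̂ → IsDiamond T
  diamond-down D with n ℕ.≤? 3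
  ... | yes n≤3 = ⊥-elim (diamond-∉D₁ T̂ D (InD-⊆ (inducedDet-blowup B) 1 (InD₁-small T n≤3)))
  ... | no  n≰3 = diamond-transfer T T̂ block (block-injective N≤n) n≡4 arc-block D
    where
    N≡4 : N ≡ 4
    N≡4 = proj₁ D
    N≤n : N ≤ n
    N≤n = subst (_≤ n) (sym N≡4) (ℕP.≰⇒> n≰3)
    n≡4 : n ≡ 4
    n≡4 = trans (ℕP.≤-antisym n≤N N≤n) N≡4
    arc-block : ∀ u v → arc T̂ u v ≡ arc T (block u) (block v)
    arc-block u v with u ≟ v
    ... | yes refl = trans (irrefl T̂ u) (sym (irrefl T (block u)))
    ... | no  u≢v  = arc-between u v (u≢v ∘ block-injective N≤n)

  shape-down : ∀ t → (N ≡ 1 ⊎ N ≡ 2 ⊎ IsDiamond T̂ ⊎ NonCRExtensionsLeave t T̂) →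
                     (n ≡ 1 ⊎ n ≡ 2 ⊎ IsDiamond T ⊎ NonCRExtensionsLeave t T)
  shape-down t (inj₁ N≡1) =
    inj₁ (ℕP.≤-antisym (subst (n ≤_) N≡1 n≤N) (inhabited (ℕP.≤-reflexive (sym N≡1))))
  shape-down t (inj₂ (inj₁ N≡2)) with ℕP.m≤n⇒m<n∨m≡n (subst (n ≤_) N≡2 n≤N)
  ... | inj₁ n<2 =
    inj₁ (ℕP.≤-antisym (ℕ.s≤s⁻¹ n<2) (inhabited (subst (0 ℕ.<_) (sym N≡2) (s≤s z≤n))))
  ... | inj₂ n≡2 = inj₂ (inj₁ n≡2)
  shape-down t (inj₂ (inj₂ (inj₁ D)))     = inj₂ (inj₂ (inj₁ (diamond-down D)))
  shape-down t (inj₂ (inj₂ (inj₂ leave))) = inj₂ (inj₂ (inj₂ (nonCRExtensionsLeave-down t leave)))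

proposition4p7 : ∀ {n N} (T : Tournament n) (a : Fin n → ℕ) (T̂ : Tournament N) →
    (∀ i → 1 ≤ a i) → IsTransitiveBlowup T a T̂ → IsCR T̂ → IsCR T
proposition4p7 {n} {N} T a T̂ a≥1 blowup (t , T̂∈D , T̂∉D′ , shape) =
  t , InD-⊆ (inducedDet-section B block∘ι) (suc t) T̂∈D
    , T̂∉D′ ∘ InD-⊆ (inducedDet-blowup B) t
    , shape-down B block∘ι t shape
  where
  B : BlowupMap T T̂
  B = blowupMap {T = T} {a} {T̂} blowup
  ι : Fin n → Fin N
  ι = proj₁ (section {T = T} {a} {T̂} blowup a≥1)
  block∘ι : ∀ i → BlowupMap.block B (ι i) ≡ i
  block∘ι = proj₂ (section {T = T} {a} {T̂} blowup a≥1)
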